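{- For every nonnegative integer $n$, $$\det\left(\binom{i+j+1}{i-j+1}\bmod 2\right)_{i,j=0}^{n-1}=C_n\bmod 2,$$ where $C_n=\frac{1}{n+1}\binom{2n}{n}$ and the determinant is computed over the integers.
   Context: For an integer $a$, $a\bmod 2$ denotes its residue in $\{0,1\}$, regarded as an ordinary integer (not as an element of $\mathbb{Z}/2\mathbb{Z}$). Binomial coefficients $\binom{a}{b}$ with $a\ge0$ vanish if $b<0$ or $b>a$. The determinant of a $0\times0$ matrix is $1$. -}

module Defs where

open import Data.Nat as ℕ using (ℕ; zero; suc; _%_; _/_)
open import Data.Nat.Combinatorics using (_C_)
open import Data.Integer as ℤ using (ℤ; +_; -[1+_])
open import Data.Fin using (Fin; zero; suc; toℕ; punchIn)

Matrix : ℕ → Set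
Matrix n = Fin n → Fin n → ℤ

sign : ℕ → ℤ
sign zero          = + 1
sign (suc zero)    = ℤ.- (+ 1)
sign (suc (suc k)) = sign k

minor : ∀ {n} → Matrix (suc n) → Fin (suc n) → Matrix n
minor A j r c = A (suc r) (punchIn j c)

sumFin : ∀ {n} → (Fin n → ℤ) → ℤ
sumFin {zero}  f = + 0
sumFin {suc n} f = f zero ℤ.+ sumFin (λ i → f (suc i))

det : ∀ {n} → Matrix n → ℤ
det {zero}  A = + 1
det {suc n} A = sumFin (λ j → sign (toℕ j) ℤ.* A zero j ℤ.* det (minor A j))

-- Binomial coefficient with natural top and integer bottom index;
-- it vanishes for negative bottom index (and for bottom > top, via _C_).
binomℤ : ℕ → ℤ → ℕ
binomℤ a (+ b)    = a C b
binomℤ a -[1+ _ ] = 0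

catalan : ℕ → ℕ
catalan n = ((2 ℕ.* n) C n) / suc n

entry : ℕ → ℕ → ℕ
entry i j = binomℤ (i ℕ.+ j ℕ.+ 1) ((+ i ℤ.- + j) ℤ.+ + 1) % 2

M : (n : ℕ) → Matrix n
M n i j = + entry (toℕ i) (toℕ j)

-- The matrix is lower Hessenberg with ones on the superdiagonal, so expanding along the
-- first row expresses the determinant of its N × N diagonal block starting at (m, m)
-- through the blocks further down the diagonal.  By induction on N that determinant is
-- binom(2m + 2N + 1, N) mod 2: the expansion reduces this to the vanishing of an
-- alternating convolution of the 0/1 sequences binom(2m + k, k) mod 2 and
-- binom(2E + 1, j) mod 2, and Lucas' theorem for p = 2 halves such convolutions until
-- they cancel termwise.  For m = 0 one is left with binom(2n + 1, n), which is
-- C_n + 2 binom(2n, n + 1).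

module Submission where

open import Data.Fin using (Fin; zero; suc; toℕ; punchIn)
open import Data.Integer as ℤ using (ℤ; +_; _⊖_; _+_; _*_; _-_; -_)
import Data.Integer.Properties as ℤ
open import Data.Integer.Tactic.RingSolver as ℤ-Solver using ()
open import Data.Nat as ℕ using (ℕ; zero; suc; _%_; _/_; _≤_; _<_; ⌊_/2⌋)
import Data.Nat.Properties as ℕ
open import Data.Nat.Tactic.RingSolver as ℕ-Solver using ()
open import Data.Nat.Combinatorics using (_C_; nC1≡n; nCk≡nC[n∸k]; nCk+nC[k+1]≡[n+1]C[k+1])
open import Data.Nat.DivMod using (%-distribˡ-+; [m+kn]%n≡m%n; m*n/n≡m)
open import Data.Nat.Induction using (<-rec)
open import Function using (_∘_)
open import Relation.Binary.PropositionalEquality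

open import Defs

double : ℕ → ℕ
double zero    = zero
double (suc n) = suc (suc (double n))

double-+ : ∀ m n → double (m ℕ.+ n) ≡ double m ℕ.+ double n
double-+ zero    n = refl
double-+ (suc m) n = cong (λ k → suc (suc k)) (double-+ m n)

double≡n+n : ∀ n → double n ≡ n ℕ.+ n
double≡n+n zero    = refl
double≡n+n (suc n) = cong suc (trans (cong suc (double≡n+n n)) (sym (ℕ.+-suc n n)))

⌊double/2⌋ : ∀ n → ⌊ double n /2⌋ ≡ n
⌊double/2⌋ zero    = refl
⌊double/2⌋ (suc n) = cong suc (⌊double/2⌋ n)

⌊suc-double/2⌋ : ∀ n → ⌊ suc (double n) /2⌋ ≡ n
⌊suc-double/2⌋ zero    = refl
⌊suc-double/2⌋ (suc n) = cong suc (⌊suc-double/2⌋ n)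

data Parity : ℕ → Set where
  even : ∀ h → Parity (double h)
  odd  : ∀ h → Parity (suc (double h))

parity : ∀ n → Parity n
parity zero = even zero
parity (suc n) with parity n
... | even h = odd h
... | odd h  = even (suc h)

infix 4 _≡₂_
record _≡₂_ (m n : ℕ) : Set where
  constructor mod2
  field %2-≡ : m % 2 ≡ n % 2
open _≡₂_

≡⇒≡₂ : ∀ {m n} → m ≡ n → m ≡₂ n
≡⇒≡₂ refl = mod2 refl

≡₂-trans : ∀ {m n o} → m ≡₂ n → n ≡₂ o → m ≡₂ o
≡₂-trans (mod2 p) (mod2 q) = mod2 (trans p q)

+-cong-≡₂ : ∀ {m m′ n n′} → m ≡₂ m′ → n ≡₂ n′ → m ℕ.+ n ≡₂ m′ ℕ.+ n′
+-cong-≡₂ {m} {m′} {n} {n′} (mod2 p) (mod2 q) = mod2 (begin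
  (m ℕ.+ n) % 2           ≡⟨ %-distribˡ-+ m n 2 ⟩
  (m % 2 ℕ.+ n % 2) % 2   ≡⟨ cong₂ (λ a b → (a ℕ.+ b) % 2) p q ⟩
  (m′ % 2 ℕ.+ n′ % 2) % 2 ≡⟨ %-distribˡ-+ m′ n′ 2 ⟨
  (m′ ℕ.+ n′) % 2         ∎)
  where open ≡-Reasoning

m+2n≡₂m : ∀ m n → m ℕ.+ double n ≡₂ m
m+2n≡₂m m n = mod2 (begin
  (m ℕ.+ double n) % 2 ≡⟨ cong (λ k → (m ℕ.+ k) % 2) (trans (double≡n+n n) (n+n≡n*2 n)) ⟩
  (m ℕ.+ n ℕ.* 2) % 2  ≡⟨ [m+kn]%n≡m%n m n 2 ⟩
  m % 2                ∎)
  where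
  open ≡-Reasoning
  n+n≡n*2 : ∀ n → n ℕ.+ n ≡ n ℕ.* 2
  n+n≡n*2 = ℕ-Solver.solve-∀

pascal : ∀ n k → suc n C suc k ≡ n C k ℕ.+ n C suc k
pascal n k = sym (nCk+nC[k+1]≡[n+1]C[k+1] n k)

C-even-even : ∀ a b → double a C double b ≡₂ a C b
C-even-odd  : ∀ a b → double a C suc (double b) ≡₂ 0
C-odd-even  : ∀ a b → suc (double a) C double b ≡₂ a C b
C-odd-odd   : ∀ a b → suc (double a) C suc (double b) ≡₂ a C b

C-even-even zero    zero    = mod2 refl
C-even-even zero    (suc b) = mod2 refl
C-even-even (suc a) zero    = mod2 refl
C-even-even (suc a) (suc b) = ≡₂-trans (≡⇒≡₂ (pascal (suc (double a)) (suc (double b))))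
  (≡₂-trans (+-cong-≡₂ (C-odd-odd a b) (C-odd-even a (suc b))) (≡⇒≡₂ (sym (pascal a b))))

C-even-odd zero    b = mod2 refl
C-even-odd (suc a) b = ≡₂-trans (≡⇒≡₂ (pascal (suc (double a)) (double b)))
  (≡₂-trans (+-cong-≡₂ (C-odd-even a b) (C-odd-odd a b))
            (≡₂-trans (≡⇒≡₂ (sym (double≡n+n (a C b)))) (m+2n≡₂m 0 (a C b))))

C-odd-even a zero    = mod2 refl
C-odd-even a (suc b) = ≡₂-trans (≡⇒≡₂ (pascal (double a) (suc (double b))))
  (+-cong-≡₂ (C-even-odd a b) (C-even-even a (suc b)))

C-odd-odd a b = ≡₂-trans (≡⇒≡₂ (pascal (double a) (double b)))
  (≡₂-trans (+-cong-≡₂ (C-even-even a b) (C-even-odd a b)) (≡⇒≡₂ (ℕ.+-identityʳ (a C b))))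

evens odds : (ℕ → ℤ) → ℕ → ℤ
evens f k = f (double k)
odds  f k = f (suc (double k))

conv : (ℕ → ℤ) → (ℕ → ℤ) → ℕ → ℤ
conv f g zero    = + 0
conv f g (suc n) = f 0 * g n + conv (f ∘ suc) g n

altConv : (ℕ → ℤ) → (ℕ → ℤ) → ℕ → ℤ
altConv f g zero    = + 0
altConv f g (suc n) = f 0 * g n - altConv (f ∘ suc) g n

conv-cong : ∀ {f f′ g g′} → (∀ k → f k ≡ f′ k) → (∀ k → g k ≡ g′ k) →
            ∀ n → conv f g n ≡ conv f′ g′ n
conv-cong p q zero    = refl
conv-cong p q (suc n) = cong₂ _+_ (cong₂ _*_ (p 0) (q n)) (conv-cong (p ∘ suc) q n)

altConv-cong : ∀ {f f′ g} → (∀ k → f k ≡ f′ k) → ∀ n → altConv f g n ≡ altConv f′ g n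
altConv-cong p zero    = refl
altConv-cong p (suc n) = cong₂ _-_ (cong (ℤ._* _) (p 0)) (altConv-cong (p ∘ suc) n)

conv-zeroˡ : ∀ g n → conv (λ _ → + 0) g n ≡ + 0
conv-zeroˡ g zero    = refl
conv-zeroˡ g (suc n) = trans (ℤ.+-identityˡ _) (conv-zeroˡ g n)

conv-zeroʳ : ∀ f n → conv f (λ _ → + 0) n ≡ + 0
conv-zeroʳ f zero    = refl
conv-zeroʳ f (suc n) = cong₂ _+_ (ℤ.*-zeroʳ (f 0)) (conv-zeroʳ (f ∘ suc) n)

x+[y+z]≡[x+z]+y : ∀ x y z → x + (y + z) ≡ (x + z) + y
x+[y+z]≡[x+z]+y = ℤ-Solver.solve-∀

x-[y-z]≡[x+z]-y : ∀ x y z → x - (y - z) ≡ (x + z) - y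
x-[y-z]≡[x+z]-y = ℤ-Solver.solve-∀

conv-double : ∀ f g q →
  conv f g (double q) ≡ conv (evens f) (odds g) q + conv (odds f) (evens g) q
conv-suc-double : ∀ f g q →
  conv f g (suc (double q)) ≡ conv (evens f) (evens g) (suc q) + conv (odds f) (odds g) q

conv-double f g zero    = refl
conv-double f g (suc q) = trans (cong (_+_ (f 0 * g (suc (double q)))) (conv-suc-double (f ∘ suc) g q))
  (x+[y+z]≡[x+z]+y (f 0 * g (suc (double q))) _ (conv (evens f ∘ suc) (odds g) q))
conv-suc-double f g q   = trans (cong (_+_ (f 0 * g (double q))) (conv-double (f ∘ suc) g q))
  (x+[y+z]≡[x+z]+y (f 0 * g (double q)) _ (conv (evens f ∘ suc) (evens g) q))

altConv-double : ∀ f g q →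
  altConv f g (double q) ≡ conv (evens f) (odds g) q - conv (odds f) (evens g) q
altConv-suc-double : ∀ f g q →
  altConv f g (suc (double q)) ≡ conv (evens f) (evens g) (suc q) - conv (odds f) (odds g) q

altConv-double f g zero    = refl
altConv-double f g (suc q) = trans (cong (_-_ (f 0 * g (suc (double q)))) (altConv-suc-double (f ∘ suc) g q))
  (x-[y-z]≡[x+z]-y (f 0 * g (suc (double q))) _ (conv (evens f ∘ suc) (odds g) q))
altConv-suc-double f g q   = trans (cong (_-_ (f 0 * g (double q))) (altConv-double (f ∘ suc) g q))
  (x-[y-z]≡[x+z]-y (f 0 * g (double q)) _ (conv (evens f ∘ suc) (evens g) q))

sumFin-cong : ∀ {n} {f g : Fin n → ℤ} → (∀ i → f i ≡ g i) → sumFin f ≡ sumFin g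
sumFin-cong {zero}  p = refl
sumFin-cong {suc n} p = cong₂ _+_ (p zero) (sumFin-cong (p ∘ suc))

sumFin-zero : ∀ {n} {f : Fin n → ℤ} → (∀ i → f i ≡ + 0) → sumFin f ≡ + 0
sumFin-zero {zero}  p = refl
sumFin-zero {suc n} p = cong₂ _+_ (p zero) (sumFin-zero (p ∘ suc))

det-cong : ∀ {n} {A B : Matrix n} → (∀ i j → A i j ≡ B i j) → det A ≡ det B
det-cong {zero}  p = refl
det-cong {suc n} p = sumFin-cong (λ j →
  cong₂ _*_ (cong (sign (toℕ j) *_) (p zero j)) (det-cong (λ r c → p (suc r) (punchIn j c))))

det-1×1 : (A : Matrix 1) → det A ≡ A zero zero
det-1×1 A = trans (ℤ.+-identityʳ _) (trans (ℤ.*-identityʳ _) (ℤ.*-identityˡ _))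

det-twoEntryFirstRow : ∀ {n} (A : Matrix (suc (suc n))) → (∀ j → A zero (suc (suc j)) ≡ + 0) →
  det A ≡ A zero zero * det (minor A zero) - A zero (suc zero) * det (minor A (suc zero))
det-twoEntryFirstRow A row₀ = begin
  t₀ + (t₁ + sumFin rest)
    ≡⟨ cong (λ s → t₀ + (t₁ + s)) (sumFin-zero restVanishes) ⟩
  t₀ + (t₁ + + 0)
    ≡⟨ expand (A zero zero) (det (minor A zero)) (A zero (suc zero)) (det (minor A (suc zero))) ⟩
  A zero zero * det (minor A zero) - A zero (suc zero) * det (minor A (suc zero)) ∎
  where
  open ≡-Reasoning
  t₀ = sign 0 * A zero zero * det (minor A zero)
  t₁ = sign 1 * A zero (suc zero) * det (minor A (suc zero))
  rest : Fin _ → ℤ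
  rest j = sign (toℕ (suc (suc j))) * A zero (suc (suc j)) * det (minor A (suc (suc j)))
  restVanishes : ∀ j → rest j ≡ + 0
  restVanishes j = trans (cong (λ a → sign (toℕ j) * a * det (minor A (suc (suc j)))) (row₀ j))
                         (cong (_* det (minor A (suc (suc j)))) (ℤ.*-zeroʳ (sign (toℕ j))))
  expand : ∀ a d₀ b d₁ → (+ 1 * a) * d₀ + ((- + 1 * b) * d₁ + + 0) ≡ a * d₀ - b * d₁
  expand = ℤ-Solver.solve-∀

shift : (ℕ → ℕ → ℤ) → ℕ → ℕ → ℤ
shift e i j = e (suc i) (suc j)

leading : (ℕ → ℕ → ℤ) → (N : ℕ) → Matrix N
leading e N i j = e (toℕ i) (toℕ j)

-- Replacing the first column by an arbitrary v is what makes the first-row expansion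
-- recurse: the second minor is again of this form (det-withFirstColumn-hessenberg).
withFirstColumn : (ℕ → ℤ) → (ℕ → ℕ → ℤ) → (N : ℕ) → Matrix N
withFirstColumn v e N i zero    = v (toℕ i)
withFirstColumn v e N i (suc j) = e (toℕ i) (suc (toℕ j))

det-leading : ∀ e N → det (leading e N) ≡ det (withFirstColumn (λ i → e i 0) e N)
det-leading e N = det-cong {A = leading e N} λ { i zero → refl ; i (suc j) → refl }

det-withFirstColumn-hessenberg : ∀ e → e 0 1 ≡ + 1 → (∀ d → e 0 (suc (suc d)) ≡ + 0) → ∀ v N →
  det (withFirstColumn v e (suc (suc N)))
    ≡ v 0 * det (leading (shift e) (suc N)) - det (withFirstColumn (v ∘ suc) (shift e) (suc N))
det-withFirstColumn-hessenberg e superdiagonal beyond v N = begin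
  det A
    ≡⟨ det-twoEntryFirstRow A (beyond ∘ toℕ) ⟩
  v 0 * det (minor A zero) - e 0 1 * det (minor A (suc zero))
    ≡⟨ cong₂ (λ a d → v 0 * det (minor A zero) - a * d) superdiagonal (det-cong minor₁) ⟩
  v 0 * det (leading (shift e) (suc N)) - + 1 * det (withFirstColumn (v ∘ suc) (shift e) (suc N))
    ≡⟨ cong (λ d → v 0 * det (leading (shift e) (suc N)) - d) (ℤ.*-identityˡ _) ⟩
  v 0 * det (leading (shift e) (suc N)) - det (withFirstColumn (v ∘ suc) (shift e) (suc N)) ∎
  where
  open ≡-Reasoning
  A = withFirstColumn v e (suc (suc N))
  minor₁ : ∀ r c → minor A (suc zero) r c ≡ withFirstColumn (v ∘ suc) (shift e) (suc N) r c
  minor₁ r zero    = refl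
  minor₁ r (suc c) = refl

binomBit : ℕ → ℕ → ℤ
binomBit n k = + ((n C k) % 2)

multichooseBit : ℕ → ℕ → ℤ
multichooseBit m k = binomBit (m ℕ.+ k) k

oddBinomBit : ℕ → ℕ → ℤ
oddBinomBit E = binomBit (suc (double E))

double-+-suc-double : ∀ m k → double m ℕ.+ suc (double k) ≡ suc (double (m ℕ.+ k))
double-+-suc-double m k = trans (ℕ.+-suc (double m) (double k)) (cong suc (sym (double-+ m k)))

evens-multichooseBit-even : ∀ m k → evens (multichooseBit (double m)) k ≡ multichooseBit m k
evens-multichooseBit-even m k = trans (cong (λ n → binomBit n (double k)) (sym (double-+ m k)))
  (cong +_ (%2-≡ (C-even-even (m ℕ.+ k) k)))

odds-multichooseBit-even : ∀ m k → odds (multichooseBit (double m)) k ≡ multichooseBit m k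
odds-multichooseBit-even m k = trans (cong (λ n → binomBit n (suc (double k))) (double-+-suc-double m k))
  (cong +_ (%2-≡ (C-odd-odd (m ℕ.+ k) k)))

evens-multichooseBit-odd : ∀ m k → evens (multichooseBit (suc (double m))) k ≡ multichooseBit m k
evens-multichooseBit-odd m k = trans (cong (λ n → binomBit (suc n) (double k)) (sym (double-+ m k)))
  (cong +_ (%2-≡ (C-odd-even (m ℕ.+ k) k)))

odds-multichooseBit-odd : ∀ m k → odds (multichooseBit (suc (double m))) k ≡ + 0
odds-multichooseBit-odd m k = trans (cong (λ n → binomBit (suc n) (suc (double k))) (double-+-suc-double m k))
  (cong +_ (%2-≡ (C-even-odd (suc (m ℕ.+ k)) k)))

evens-binomBit-even : ∀ E j → evens (binomBit (double E)) j ≡ binomBit E j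
evens-binomBit-even E j = cong +_ (%2-≡ (C-even-even E j))

odds-binomBit-even : ∀ E j → odds (binomBit (double E)) j ≡ + 0
odds-binomBit-even E j = cong +_ (%2-≡ (C-even-odd E j))

evens-binomBit-odd : ∀ E j → evens (binomBit (suc (double E))) j ≡ binomBit E j
evens-binomBit-odd E j = cong +_ (%2-≡ (C-odd-even E j))

odds-binomBit-odd : ∀ E j → odds (binomBit (suc (double E))) j ≡ binomBit E j
odds-binomBit-odd E j = cong +_ (%2-≡ (C-odd-odd E j))

multichooseConv : ℕ → ℕ → ℕ → ℤ
multichooseConv m E = conv (multichooseBit m) (binomBit E)

multichooseConv-double : ∀ m x q →
  multichooseConv m (m ℕ.+ double x) (double q) ≡ multichooseConv ⌊ m /2⌋ (⌊ m /2⌋ ℕ.+ x) q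
multichooseConv-double m x q with parity m
... | even h rewrite ⌊double/2⌋ h | sym (double-+ h x) =
  trans (conv-double (multichooseBit (double h)) (binomBit (double E)) q)
    (trans (cong₂ _+_ (trans (conv-cong (evens-multichooseBit-even h) (odds-binomBit-even E) q)
                             (conv-zeroʳ (multichooseBit h) q))
                      (conv-cong (odds-multichooseBit-even h) (evens-binomBit-even E) q))
           (ℤ.+-identityˡ (multichooseConv h E q)))
  where E = h ℕ.+ x
... | odd h rewrite ⌊suc-double/2⌋ h | sym (double-+ h x) =
  trans (conv-double (multichooseBit (suc (double h))) (binomBit (suc (double E))) q)
    (trans (cong₂ _+_ (conv-cong (evens-multichooseBit-odd h) (odds-binomBit-odd E) q)
                      (trans (conv-cong (odds-multichooseBit-odd h) (evens-binomBit-odd E) q)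
                             (conv-zeroˡ (binomBit E) q)))
           (ℤ.+-identityʳ (multichooseConv h E q)))
  where E = h ℕ.+ x

multichooseConv-suc-double : ∀ m x q →
  multichooseConv m (m ℕ.+ double x) (suc (double q)) ≡ multichooseConv ⌊ m /2⌋ (⌊ m /2⌋ ℕ.+ x) (suc q)
multichooseConv-suc-double m x q with parity m
... | even h rewrite ⌊double/2⌋ h | sym (double-+ h x) =
  trans (conv-suc-double (multichooseBit (double h)) (binomBit (double E)) q)
    (trans (cong₂ _+_ (conv-cong (evens-multichooseBit-even h) (evens-binomBit-even E) (suc q))
                      (trans (conv-cong (odds-multichooseBit-even h) (odds-binomBit-even E) q)
                             (conv-zeroʳ (multichooseBit h) q)))
           (ℤ.+-identityʳ (multichooseConv h E (suc q))))
  where E = h ℕ.+ x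
... | odd h rewrite ⌊suc-double/2⌋ h | sym (double-+ h x) =
  trans (conv-suc-double (multichooseBit (suc (double h))) (binomBit (suc (double E))) q)
    (trans (cong₂ _+_ (conv-cong (evens-multichooseBit-odd h) (evens-binomBit-odd E) (suc q))
                      (trans (conv-cong (odds-multichooseBit-odd h) (odds-binomBit-odd E) q)
                             (conv-zeroˡ (binomBit E) q)))
           (ℤ.+-identityʳ (multichooseConv h E (suc q))))
  where E = h ℕ.+ x

-- Halving either identifies the two sides outright (when q is even) or reproduces
-- the same statement for ⌊ m /2⌋ and q = 2r + 1 replaced by r.
multichooseConv-stationary : ∀ q m →
  multichooseConv m (m ℕ.+ double (suc q)) (suc (suc q)) ≡ multichooseConv m (m ℕ.+ double (suc q)) (suc q)
multichooseConv-stationary = <-rec Stationary step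
  where
  Stationary : ℕ → Set
  Stationary q = ∀ m →
    multichooseConv m (m ℕ.+ double (suc q)) (suc (suc q)) ≡ multichooseConv m (m ℕ.+ double (suc q)) (suc q)
  step : ∀ q → (∀ {r} → r < q → Stationary r) → Stationary q
  step q rec m with parity q
  ... | even r = trans (multichooseConv-double m (suc (double r)) (suc r))
                       (sym (multichooseConv-suc-double m (suc (double r)) r))
  ... | odd r  = trans (multichooseConv-suc-double m (double (suc r)) (suc r))
                       (trans (rec r<1+2r ⌊ m /2⌋) (sym (multichooseConv-double m (double (suc r)) (suc r))))
    where
    r<1+2r : r < suc (double r)
    r<1+2r = ℕ.s≤s (subst (r ≤_) (sym (double≡n+n r)) (ℕ.m≤m+n r r))

altConv-double-multichoose : ∀ m E q →
  altConv (multichooseBit (double m)) (oddBinomBit E) (double q) ≡ multichooseConv m E q - multichooseConv m E q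
altConv-double-multichoose m E q = trans (altConv-double (multichooseBit (double m)) (oddBinomBit E) q)
  (cong₂ _-_ (conv-cong (evens-multichooseBit-even m) (odds-binomBit-odd E) q)
             (conv-cong (odds-multichooseBit-even m) (evens-binomBit-odd E) q))

altConv-suc-double-multichoose : ∀ m E q →
  altConv (multichooseBit (double m)) (oddBinomBit E) (suc (double q))
    ≡ multichooseConv m E (suc q) - multichooseConv m E q
altConv-suc-double-multichoose m E q = trans (altConv-suc-double (multichooseBit (double m)) (oddBinomBit E) q)
  (cong₂ _-_ (conv-cong (evens-multichooseBit-even m) (evens-binomBit-odd E) (suc q))
             (conv-cong (odds-multichooseBit-even m) (odds-binomBit-odd E) q))

altConv-multichoose-vanishes : ∀ m d →
  altConv (multichooseBit (double m)) (oddBinomBit (m ℕ.+ suc d)) (suc (suc d)) ≡ + 0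
altConv-multichoose-vanishes m d with parity d
... | even q = trans (altConv-double-multichoose m (m ℕ.+ suc (double q)) (suc q))
                     (ℤ.+-inverseʳ (multichooseConv m (m ℕ.+ suc (double q)) (suc q)))
... | odd q  = trans (altConv-suc-double-multichoose m (m ℕ.+ double (suc q)) (suc q))
                     (ℤ.i≡j⇒i-j≡0 (multichooseConv-stationary q m))

altConv-multichoose-tail : ∀ m d →
  altConv (multichooseBit (double m) ∘ suc) (oddBinomBit (m ℕ.+ suc d)) (suc d) ≡ oddBinomBit (m ℕ.+ suc d) (suc d)
altConv-multichoose-tail m d =
  sym (trans (sym (ℤ.*-identityˡ _)) (ℤ.i-j≡0⇒i≡j _ _ (altConv-multichoose-vanishes m d)))

[+m]-[+n]+1≡[m+1]⊖n : ∀ m n → (+ m - + n) + + 1 ≡ m ℕ.+ 1 ⊖ n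
[+m]-[+n]+1≡[m+1]⊖n m n = trans (cong (_+ + 1) (ℤ.[+m]-[+n]≡m⊖n m n)) (ℤ.distribˡ-⊖-+-pos 1 m n)

entry-offset : ∀ i k → entry i (i ℕ.+ k) ≡ binomℤ (i ℕ.+ (i ℕ.+ k) ℕ.+ 1) (1 ⊖ k) % 2
entry-offset i k = cong (λ b → binomℤ (i ℕ.+ (i ℕ.+ k) ℕ.+ 1) b % 2)
  (trans ([+m]-[+n]+1≡[m+1]⊖n i (i ℕ.+ k)) (ℤ.+-cancelˡ-⊖ i 1 k))

entry-column : ∀ m k → entry (m ℕ.+ k) m ≡ ((double m ℕ.+ suc k) C suc k) % 2
entry-column m k = begin
  binomℤ (m ℕ.+ k ℕ.+ m ℕ.+ 1) ((+ (m ℕ.+ k) - + m) + + 1) % 2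
    ≡⟨ cong (λ b → binomℤ (m ℕ.+ k ℕ.+ m ℕ.+ 1) b % 2) index ⟩
  ((m ℕ.+ k ℕ.+ m ℕ.+ 1) C suc k) % 2
    ≡⟨ cong (λ n → (n C suc k) % 2) (trans (top m k) (cong (ℕ._+ suc k) (sym (double≡n+n m)))) ⟩
  ((double m ℕ.+ suc k) C suc k) % 2 ∎
  where
  open ≡-Reasoning
  index : (+ (m ℕ.+ k) - + m) + + 1 ≡ + suc k
  index = begin
    (+ (m ℕ.+ k) - + m) + + 1 ≡⟨ [+m]-[+n]+1≡[m+1]⊖n (m ℕ.+ k) m ⟩
    m ℕ.+ k ℕ.+ 1 ⊖ m         ≡⟨ cong (_⊖ m) (ℕ.+-assoc m k 1) ⟩
    m ℕ.+ (k ℕ.+ 1) ⊖ m       ≡⟨ ℤ.≤-⊖ (ℕ.m≤m+n m (k ℕ.+ 1)) ⟩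
    + (m ℕ.+ (k ℕ.+ 1) ℕ.∸ m) ≡⟨ cong +_ (trans (ℕ.m+n∸m≡n m (k ℕ.+ 1)) (ℕ.+-comm k 1)) ⟩
    + suc k                   ∎
  top : ∀ m k → m ℕ.+ k ℕ.+ m ℕ.+ 1 ≡ m ℕ.+ m ℕ.+ suc k
  top = ℕ-Solver.solve-∀

-- entriesFrom m is the matrix M with its first m rows and columns removed
-- (entriesFrom-entry); building it by iterated shift makes the minors in its
-- first-row expansion literally of the form entriesFrom (suc m).
entriesFrom : ℕ → ℕ → ℕ → ℤ
entriesFrom zero    i j = + entry i j
entriesFrom (suc m)     = shift (entriesFrom m)

entriesFrom-entry : ∀ m i j → entriesFrom m i j ≡ + entry (m ℕ.+ i) (m ℕ.+ j)
entriesFrom-entry zero    i j = refl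
entriesFrom-entry (suc m) i j = trans (entriesFrom-entry m (suc i) (suc j))
  (cong₂ (λ a b → + entry a b) (ℕ.+-suc m i) (ℕ.+-suc m j))

entriesFrom-superdiagonal : ∀ m → entriesFrom m 0 1 ≡ + 1
entriesFrom-superdiagonal m = trans (entriesFrom-entry m 0 1)
  (cong +_ (trans (cong (λ i → entry i (m ℕ.+ 1)) (ℕ.+-identityʳ m)) (entry-offset m 1)))

entriesFrom-beyond : ∀ m d → entriesFrom m 0 (suc (suc d)) ≡ + 0
entriesFrom-beyond m d = trans (entriesFrom-entry m 0 (suc (suc d)))
  (cong +_ (trans (cong (λ i → entry i (m ℕ.+ suc (suc d))) (ℕ.+-identityʳ m)) (entry-offset m (suc (suc d)))))

entriesFrom-column : ∀ m i → entriesFrom m i 0 ≡ multichooseBit (double m) (suc i)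
entriesFrom-column m i = trans (entriesFrom-entry m i 0)
  (cong +_ (trans (cong (entry (m ℕ.+ i)) (ℕ.+-identityʳ m)) (entry-column m i)))

det-withFirstColumn-entriesFrom : ∀ N m v →
  det (withFirstColumn v (entriesFrom m) (suc N)) ≡ altConv v (oddBinomBit (m ℕ.+ suc N)) (suc N)
det-leading-entriesFrom : ∀ N m → det (leading (entriesFrom m) N) ≡ oddBinomBit (m ℕ.+ N) N

det-withFirstColumn-entriesFrom zero m v =
  trans (det-1×1 (withFirstColumn v (entriesFrom m) 1)) (sym (trans (ℤ.+-identityʳ _) (ℤ.*-identityʳ (v 0))))
det-withFirstColumn-entriesFrom (suc N) m v = begin
  det (withFirstColumn v (entriesFrom m) (suc (suc N)))
    ≡⟨ det-withFirstColumn-hessenberg (entriesFrom m) (entriesFrom-superdiagonal m) (entriesFrom-beyond m) v N ⟩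
  v 0 * det (leading (entriesFrom (suc m)) (suc N)) - det (withFirstColumn (v ∘ suc) (entriesFrom (suc m)) (suc N))
    ≡⟨ cong₂ (λ a b → v 0 * a - b) (det-leading-entriesFrom (suc N) (suc m))
                                  (det-withFirstColumn-entriesFrom N (suc m) (v ∘ suc)) ⟩
  altConv v (oddBinomBit (suc m ℕ.+ suc N)) (suc (suc N))
    ≡⟨ cong (λ E → altConv v (oddBinomBit E) (suc (suc N))) (sym (ℕ.+-suc m (suc N))) ⟩
  altConv v (oddBinomBit (m ℕ.+ suc (suc N))) (suc (suc N)) ∎
  where open ≡-Reasoning

det-leading-entriesFrom zero    m = refl
det-leading-entriesFrom (suc N) m = begin
  det (leading (entriesFrom m) (suc N))
    ≡⟨ det-leading (entriesFrom m) (suc N) ⟩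
  det (withFirstColumn (λ i → entriesFrom m i 0) (entriesFrom m) (suc N))
    ≡⟨ det-withFirstColumn-entriesFrom N m (λ i → entriesFrom m i 0) ⟩
  altConv (λ i → entriesFrom m i 0) (oddBinomBit (m ℕ.+ suc N)) (suc N)
    ≡⟨ altConv-cong (entriesFrom-column m) (suc N) ⟩
  altConv (multichooseBit (double m) ∘ suc) (oddBinomBit (m ℕ.+ suc N)) (suc N)
    ≡⟨ altConv-multichoose-tail m N ⟩
  oddBinomBit (m ℕ.+ suc N) (suc N) ∎
  where open ≡-Reasoning

[k+1]*[n+1]C[k+1]≡[n+1]*nCk : ∀ n k → suc k ℕ.* (suc n C suc k) ≡ suc n ℕ.* (n C k)
[k+1]*[n+1]C[k+1]≡[n+1]*nCk zero    zero    = refl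
[k+1]*[n+1]C[k+1]≡[n+1]*nCk zero    (suc k) = ℕ.*-zeroʳ (suc (suc k))
[k+1]*[n+1]C[k+1]≡[n+1]*nCk (suc n) zero    =
  trans (ℕ.+-identityʳ _) (trans (nC1≡n (suc (suc n))) (sym (ℕ.*-identityʳ _)))
[k+1]*[n+1]C[k+1]≡[n+1]*nCk (suc n) (suc k) = begin
  suc (suc k) ℕ.* (suc (suc n) C suc (suc k))
    ≡⟨ cong (suc (suc k) ℕ.*_) (pascal (suc n) (suc k)) ⟩
  suc (suc k) ℕ.* (a ℕ.+ b)
    ≡⟨ regroup₁ k a b ⟩
  (suc k ℕ.* a ℕ.+ a) ℕ.+ suc (suc k) ℕ.* b
    ≡⟨ cong₂ (λ x y → (x ℕ.+ a) ℕ.+ y) ([k+1]*[n+1]C[k+1]≡[n+1]*nCk n k) ([k+1]*[n+1]C[k+1]≡[n+1]*nCk n (suc k)) ⟩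
  (suc n ℕ.* (n C k) ℕ.+ a) ℕ.+ suc n ℕ.* (n C suc k)
    ≡⟨ regroup₂ (suc n) (n C k) a (n C suc k) ⟩
  suc n ℕ.* (n C k ℕ.+ n C suc k) ℕ.+ a
    ≡⟨ cong (λ x → suc n ℕ.* x ℕ.+ a) (pascal n k) ⟨
  suc n ℕ.* a ℕ.+ a
    ≡⟨ ℕ.+-comm (suc n ℕ.* a) a ⟩
  suc (suc n) ℕ.* a ∎
  where
  open ≡-Reasoning
  a = suc n C suc k
  b = suc n C suc (suc k)
  regroup₁ : ∀ k a b → suc (suc k) ℕ.* (a ℕ.+ b) ≡ (suc k ℕ.* a ℕ.+ a) ℕ.+ suc (suc k) ℕ.* b
  regroup₁ = ℕ-Solver.solve-∀
  regroup₂ : ∀ n c a d → (n ℕ.* c ℕ.+ a) ℕ.+ n ℕ.* d ≡ n ℕ.* (c ℕ.+ d) ℕ.+ a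
  regroup₂ = ℕ-Solver.solve-∀

[n+1]*2nC[n+1]≡n*2nCn : ∀ n → suc n ℕ.* (double n C suc n) ≡ n ℕ.* (double n C n)
[n+1]*2nC[n+1]≡n*2nCn n = ℕ.+-cancelˡ-≡ (suc n ℕ.* Y) _ _ (begin
  suc n ℕ.* Y ℕ.+ suc n ℕ.* Z     ≡⟨ ℕ.*-distribˡ-+ (suc n) Y Z ⟨
  suc n ℕ.* (Y ℕ.+ Z)             ≡⟨ cong (suc n ℕ.*_) (pascal (double n) n) ⟨
  suc n ℕ.* (suc (double n) C suc n) ≡⟨ [k+1]*[n+1]C[k+1]≡[n+1]*nCk (double n) n ⟩
  suc (double n) ℕ.* Y            ≡⟨ cong (λ x → suc x ℕ.* Y) (double≡n+n n) ⟩
  suc (n ℕ.+ n) ℕ.* Y             ≡⟨ split n Y ⟩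
  suc n ℕ.* Y ℕ.+ n ℕ.* Y         ∎)
  where
  open ≡-Reasoning
  Y = double n C n
  Z = double n C suc n
  split : ∀ n Y → suc (n ℕ.+ n) ℕ.* Y ≡ suc n ℕ.* Y ℕ.+ n ℕ.* Y
  split = ℕ-Solver.solve-∀

2nC[n+1]≤2nCn : ∀ n → double n C suc n ≤ double n C n
2nC[n+1]≤2nCn n = ℕ.*-cancelˡ-≤ (suc n) (begin
  suc n ℕ.* (double n C suc n) ≡⟨ [n+1]*2nC[n+1]≡n*2nCn n ⟩
  n ℕ.* (double n C n)         ≤⟨ ℕ.*-monoˡ-≤ (double n C n) (ℕ.n≤1+n n) ⟩
  suc n ℕ.* (double n C n)     ∎)
  where open ℕ.≤-Reasoning

catalan≡2nCn∸2nC[n+1] : ∀ n → catalan n ≡ double n C n ℕ.∸ double n C suc n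
catalan≡2nCn∸2nC[n+1] n = begin
  ((2 ℕ.* n) C n) / suc n     ≡⟨ cong (λ k → (k C n) / suc n) 2*n≡double ⟩
  Y / suc n                   ≡⟨ cong (_/ suc n) Y≡[Y∸Z]*[n+1] ⟩
  (Y ℕ.∸ Z) ℕ.* suc n / suc n ≡⟨ m*n/n≡m (Y ℕ.∸ Z) (suc n) ⟩
  Y ℕ.∸ Z                     ∎
  where
  open ≡-Reasoning
  Y = double n C n
  Z = double n C suc n
  2*n≡double : 2 ℕ.* n ≡ double n
  2*n≡double = trans (cong (n ℕ.+_) (ℕ.+-identityʳ n)) (sym (double≡n+n n))
  Y≡[Y∸Z]*[n+1] : Y ≡ (Y ℕ.∸ Z) ℕ.* suc n
  Y≡[Y∸Z]*[n+1] = sym (begin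
    (Y ℕ.∸ Z) ℕ.* suc n               ≡⟨ ℕ.*-distribʳ-∸ (suc n) Y Z ⟩
    Y ℕ.* suc n ℕ.∸ Z ℕ.* suc n       ≡⟨ cong₂ ℕ._∸_ (ℕ.*-comm Y (suc n))
                                                   (trans (ℕ.*-comm Z (suc n)) ([n+1]*2nC[n+1]≡n*2nCn n)) ⟩
    (Y ℕ.+ n ℕ.* Y) ℕ.∸ n ℕ.* Y       ≡⟨ ℕ.m+n∸n≡m Y (n ℕ.* Y) ⟩
    Y                                 ∎)

[2n+1]Cn≡2nCn+2nC[n+1] : ∀ n → suc (double n) C n ≡ double n C n ℕ.+ double n C suc n
[2n+1]Cn≡2nCn+2nC[n+1] n = begin
  suc (double n) C n                  ≡⟨ nCk≡nC[n∸k] n≤2n+1 ⟩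
  suc (double n) C (suc (double n) ℕ.∸ n) ≡⟨ cong (suc (double n) C_) [2n+1]∸n≡n+1 ⟩
  suc (double n) C suc n              ≡⟨ pascal (double n) n ⟩
  double n C n ℕ.+ double n C suc n   ∎
  where
  open ≡-Reasoning
  n≤2n : n ≤ double n
  n≤2n = subst (n ≤_) (sym (double≡n+n n)) (ℕ.m≤m+n n n)
  n≤2n+1 : n ≤ suc (double n)
  n≤2n+1 = ℕ.m≤n⇒m≤1+n n≤2n
  [2n+1]∸n≡n+1 : suc (double n) ℕ.∸ n ≡ suc n
  [2n+1]∸n≡n+1 = begin
    suc (double n) ℕ.∸ n    ≡⟨ ℕ.+-∸-assoc 1 n≤2n ⟩
    suc (double n ℕ.∸ n)    ≡⟨ cong (λ k → suc (k ℕ.∸ n)) (double≡n+n n) ⟩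
    suc (n ℕ.+ n ℕ.∸ n)     ≡⟨ cong suc (ℕ.m+n∸n≡m n n) ⟩
    suc n                   ∎

[2n+1]Cn≡₂catalan : ∀ n → suc (double n) C n ≡₂ catalan n
[2n+1]Cn≡₂catalan n = ≡₂-trans (≡⇒≡₂ (begin
  suc (double n) C n                ≡⟨ [2n+1]Cn≡2nCn+2nC[n+1] n ⟩
  Y ℕ.+ Z                           ≡⟨ cong (ℕ._+ Z) (ℕ.m∸n+n≡m (2nC[n+1]≤2nCn n)) ⟨
  (Y ℕ.∸ Z) ℕ.+ Z ℕ.+ Z             ≡⟨ ℕ.+-assoc (Y ℕ.∸ Z) Z Z ⟩
  (Y ℕ.∸ Z) ℕ.+ (Z ℕ.+ Z)           ≡⟨ cong ((Y ℕ.∸ Z) ℕ.+_) (double≡n+n Z) ⟨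
  (Y ℕ.∸ Z) ℕ.+ double Z            ∎))
  (≡₂-trans (m+2n≡₂m (Y ℕ.∸ Z) Z) (≡⇒≡₂ (sym (catalan≡2nCn∸2nC[n+1] n))))
  where
  open ≡-Reasoning
  Y = double n C n
  Z = double n C suc n

mainTheorem16 : (n : ℕ) → det (M n) ≡ + (catalan n % 2)
mainTheorem16 n = begin
  det (leading (entriesFrom 0) n) ≡⟨ det-leading-entriesFrom n 0 ⟩
  oddBinomBit n n                 ≡⟨ cong +_ (%2-≡ ([2n+1]Cn≡₂catalan n)) ⟩
  + (catalan n % 2)               ∎
  where open ≡-Reasoning
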